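{- Let $G$ be a finite abelian group of order $n\ge2$ and let $t$ be an integer with $2\le t\le n-1$. Then $$s(G,t) \ge \left\lfloor \left( \frac{n}{2\,\sigma(G,t)}\right)^{1/t}\right\rfloor.$$
   Context: $G$ is written additively. For a positive integer $h$, $\mathrm{Tor}(G,h)=\{x\in G : hx=0\}$, and $\sigma(G,t)=\sum_{k=1}^t |\mathrm{Tor}(G,k)|$. A subset $A=\{a_1,\dots,a_m\}$ (with $m\ge1$) of $G$ is called $t$-independent if whenever $\lambda_1a_1+\cdots+\lambda_ma_m=0$ for integers $\lambda_i$ with $\sum|\lambda_i|\le t$, we have all $\lambda_i=0$. $s(G,t)$ denotes the largest size of a $t$-independent subset of $G$ ($0$ if there is none). -}

module Defs where

open import Level using (0ℓ)
open import Algebra.Bundles using (AbelianGroup)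
open import Data.Nat using (ℕ; zero; suc; _+_; _*_; _≤_)
open import Data.Integer using (ℤ; +_; -[1+_]; ∣_∣)
open import Data.Fin using (Fin; zero; suc; _≟_)
open import Data.Product using (Σ; _×_; ∃)
open import Relation.Nullary using (Dec; yes; no; ¬_)
open import Relation.Binary.PropositionalEquality using (_≡_)
import Relation.Binary.PropositionalEquality as ≡

record FinAbGroup (n : ℕ) : Set₁ where
  field
    G : AbelianGroup 0ℓ 0ℓ
  open AbelianGroup G public
  field
    enum       : Fin n → Carrier
    index      : Carrier → Fin n
    enum-index : ∀ x → enum (index x) ≈ x
    enum-inj   : ∀ i j → enum i ≈ enum j → i ≡ j

module _ {n : ℕ} (F : FinAbGroup n) where
  open FinAbGroup F

  mulℕ : ℕ → Carrier → Carrier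
  mulℕ zero    x = ε
  mulℕ (suc k) x = x ∙ mulℕ k x

  mulℤ : ℤ → Carrier → Carrier
  mulℤ (+ k)      x = mulℕ k x
  mulℤ -[1+ k ]   x = (mulℕ (suc k) x) ⁻¹

  gsum : (m : ℕ) → (Fin m → Carrier) → Carrier
  gsum zero    f = ε
  gsum (suc m) f = f zero ∙ gsum m (λ i → f (suc i))

  _≈?_ : (x y : Carrier) → Dec (x ≈ y)
  x ≈? y with index x ≟ index y
  ... | yes p = yes (trans (sym (enum-index x))
                      (trans (reflexive (≡.cong enum p))
                             (enum-index y)))
  ... | no ¬p = no (λ x≈y → ¬p (enum-inj (index x) (index y)
                      (trans (enum-index x) (trans x≈y (sym (enum-index y))))))

  countFin : (m : ℕ) → (Fin m → Carrier) → ℕ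
  countFin zero    f = 0
  countFin (suc m) f with f zero ≈? ε
  ... | yes _ = suc (countFin m (λ i → f (suc i)))
  ... | no  _ = countFin m (λ i → f (suc i))

  torSize : ℕ → ℕ
  torSize h = countFin n (λ i → mulℕ h (enum i))

  sigma : ℕ → ℕ
  sigma zero    = 0
  sigma (suc t) = sigma t + torSize (suc t)

  absSum : (m : ℕ) → (Fin m → ℤ) → ℕ
  absSum zero    c = 0
  absSum (suc m) c = ∣ c zero ∣ + absSum m (λ i → c (suc i))

  Distinct : (m : ℕ) → (Fin m → Carrier) → Set
  Distinct m a = ∀ i j → a i ≈ a j → i ≡ j

  IsTIndependent : ℕ → (m : ℕ) → (Fin m → Carrier) → Set
  IsTIndependent t m a =
    ∀ (c : Fin m → ℤ) → absSum m c ≤ t →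
      gsum m (λ i → mulℤ (c i) (a i)) ≈ ε → ∀ i → c i ≡ + 0

  -- "s(G,t) ≥ k": there is a t-independent subset of size at least k (size ≥ 1)
  sAtLeast : ℕ → ℕ → Set
  sAtLeast t k = Σ ℕ λ m → (1 ≤ m) × (k ≤ m) ×
    Σ (Fin m → Carrier) λ a → Distinct m a × IsTIndependent t m a

-- Build the family greedily. Let a be a t-independent family of size m < k and let S list all
-- ∑ cᵢaᵢ with ∑ ∣cᵢ∣ ≤ t − 1; S has ball m (t − 1) < 2(m + 1)ᵗ ≤ 2kᵗ entries. The family a extends
-- by x unless j·x ∈ S for some 1 ≤ j ≤ t, and for fixed j and y the solutions of j·x = y are empty
-- or a coset of Tor(G, j). So at most σ(G, t)·|S| < 2σ(G, t)kᵗ ≤ n elements are excluded.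
module Submission where

open import Defs
open import Level using (Level)
open import Data.Nat hiding (_≟_)
open import Data.Nat.Properties hiding (_≟_)
open import Data.Nat.Tactic.RingSolver using (solve-∀)
open import Data.Integer using (ℤ; +_; -[1+_]; ∣_∣; -_)
open import Data.Integer.Properties using (∣-i∣≡∣i∣)
open import Data.Fin using (Fin; zero; suc)
import Data.Fin as Fin
open import Data.Fin.Properties using (¬∀⟶∃¬; injective⇒≤)
open import Data.Vec.Functional using (tail)
import Data.Vec.Functional as Vector
open import Data.List using (List; []; _∷_; _++_; map; concatMap; length; lookup; filter; tabulate; allFin)
open import Data.List.Properties using (length-map; length-++; length-tabulate)
open import Data.List.Relation.Unary.Any using (here; there)
import Data.List.Relation.Unary.Any as Any
open import Data.List.Relation.Unary.Any.Properties using (lookup-index)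
import Data.List.Relation.Unary.All as All
open import Data.List.Relation.Unary.AllPairs using (_∷_)
open import Data.List.Relation.Unary.Unique.Propositional using (Unique)
open import Data.List.Relation.Unary.Unique.Propositional.Properties using (map⁺; filter⁺; allFin⁺)
open import Data.List.Relation.Binary.Subset.Propositional using (_⊆_)
open import Data.List.Membership.Propositional using (_∈_)
open import Data.List.Membership.Propositional.Properties
  using (∈-lookup; ∈-map⁻; ∈-filter⁺; ∈-filter⁻; ∈-allFin; ∈-concatMap⁺)
import Data.List.Membership.Setoid as SetoidMembership
import Data.List.Membership.Setoid.Properties as SetoidMembershipProperties
open import Data.Product using (Σ; _×_; _,_; proj₁; proj₂)
open import Data.Sum using (inj₁; inj₂)
open import Data.Empty using (⊥-elim)
open import Function using (_∘_; id)
open import Relation.Nullary using (Dec; ¬_; yes; no)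
open import Relation.Binary.PropositionalEquality as ≡ using (_≡_)
import Algebra.Properties.AbelianGroup as AbelianGroupProperties
import Algebra.Properties.CommutativeSemigroup as CommutativeSemigroupProperties
import Relation.Binary.Reasoning.Setoid as SetoidReasoning

-- ball m s is the number of c ∈ ℤᵐ with ∑ᵢ ∣cᵢ∣ ≤ s, and ballsBelow m s = ∑_{r<s} ball m r:
-- the first coordinate is either 0 or ±j with 1 ≤ j ≤ s and the rest has radius s − j.
mutual
  ball : ℕ → ℕ → ℕ
  ball zero    s = 1
  ball (suc m) s = ball m s + (ballsBelow m s + ballsBelow m s)

  ballsBelow : ℕ → ℕ → ℕ
  ballsBelow m zero    = 0
  ballsBelow m (suc s) = ball m s + ballsBelow m s

ball-radius-zero : ∀ m → ball m 0 ≡ 1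
ball-radius-zero zero    = ≡.refl
ball-radius-zero (suc m) rewrite ball-radius-zero m = ≡.refl

ball-suc-suc : ∀ m s → ball (suc m) (suc s) ≡ ball (suc m) s + ball m (suc s) + ball m s
ball-suc-suc m s = lemma (ball m (suc s)) (ball m s) (ballsBelow m s)
  where
  lemma : ∀ a b p → a + ((b + p) + (b + p)) ≡ (b + (p + p)) + a + b
  lemma = solve-∀

ball-≤ : ∀ m s → ball m s ≤ (1 + 2 * m) * suc m ^ s
ball-≤ zero    s       rewrite ^-zeroˡ s = ≤-refl
ball-≤ (suc m) zero    rewrite ball-radius-zero m = s≤s z≤n
ball-≤ (suc m) (suc s) = begin
  ball (suc m) (suc s)
    ≡⟨ ball-suc-suc m s ⟩
  ball (suc m) s + ball m (suc s) + ball m s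
    ≤⟨ +-mono-≤ (+-mono-≤ (ball-≤ (suc m) s) (ball-≤ m (suc s))) (ball-≤ m s) ⟩
  (1 + 2 * suc m) * Y + (1 + 2 * m) * (suc m * X) + (1 + 2 * m) * X
    ≤⟨ +-mono-≤ (+-monoʳ-≤ ((1 + 2 * suc m) * Y) (*-monoʳ-≤ (1 + 2 * m) (*-monoʳ-≤ (suc m) X≤Y)))
                (*-monoʳ-≤ (1 + 2 * m) X≤Y) ⟩
  (1 + 2 * suc m) * Y + (1 + 2 * m) * (suc m * Y) + (1 + 2 * m) * Y
    ≤⟨ m≤m+n _ Y ⟩
  (1 + 2 * suc m) * Y + (1 + 2 * m) * (suc m * Y) + (1 + 2 * m) * Y + Y
    ≡⟨ lemma m Y ⟩
  (1 + 2 * suc m) * (suc (suc m) * Y) ∎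
  where
  open ≤-Reasoning
  X = suc m ^ s
  Y = suc (suc m) ^ s
  X≤Y : X ≤ Y
  X≤Y = ^-monoˡ-≤ s (n≤1+n (suc m))
  lemma : ∀ m Y → (1 + 2 * suc m) * Y + (1 + 2 * m) * (suc m * Y) + (1 + 2 * m) * Y + Y
                  ≡ (1 + 2 * suc m) * (suc (suc m) * Y)
  lemma = solve-∀

ball-< : ∀ m s → ball m s < 2 * suc m ^ suc s
ball-< m s = begin-strict
  ball m s                  <⟨ s≤s (ball-≤ m s) ⟩
  1 + (1 + 2 * m) * X       ≤⟨ +-monoˡ-≤ _ (m^n>0 (suc m) s) ⟩
  X + (1 + 2 * m) * X       ≡⟨ lemma m X ⟩
  2 * (suc m * X)           ∎
  where
  open ≤-Reasoning
  X = suc m ^ s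
  lemma : ∀ m X → X + (1 + 2 * m) * X ≡ 2 * (suc m * X)
  lemma = solve-∀

module _ {a : Level} {A : Set a} where

  lookup-injective : ∀ {xs : List A} → Unique xs → ∀ {i j} → lookup xs i ≡ lookup xs j → i ≡ j
  lookup-injective (_ ∷ _)      {zero}  {zero}  _  = ≡.refl
  lookup-injective (x∉ ∷ _)     {zero}  {suc j} eq = ⊥-elim (All.lookup x∉ (∈-lookup j) eq)
  lookup-injective (x∉ ∷ _)     {suc i} {zero}  eq = ⊥-elim (All.lookup x∉ (∈-lookup i) (≡.sym eq))
  lookup-injective (_ ∷ unique) {suc i} {suc j} eq = ≡.cong suc (lookup-injective unique eq)

  unique-⊆⇒length-≤ : ∀ {xs ys : List A} → Unique xs → xs ⊆ ys → length xs ≤ length ys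
  unique-⊆⇒length-≤ {xs} {ys} unique xs⊆ys = injective⇒≤ position-injective
    where
    position : Fin (length xs) → Fin (length ys)
    position i = Any.index (xs⊆ys (∈-lookup i))

    position-injective : ∀ {i j} → position i ≡ position j → i ≡ j
    position-injective {i} {j} eq = lookup-injective unique (begin
      lookup xs i               ≡⟨ lookup-index (xs⊆ys (∈-lookup i)) ⟩
      lookup ys (position i)    ≡⟨ ≡.cong (lookup ys) eq ⟩
      lookup ys (position j)    ≡⟨ lookup-index (xs⊆ys (∈-lookup j)) ⟨
      lookup xs j               ∎)
      where open ≡.≡-Reasoning

  length-concatMap-≤ : ∀ {b} {B : Set b} (f : A → List B) {bound} →
                       (∀ x → length (f x) ≤ bound) → ∀ xs → length (concatMap f xs) ≤ length xs * bound
  length-concatMap-≤ f bounded []       = z≤n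
  length-concatMap-≤ f {bound} bounded (x ∷ xs) = begin
    length (f x ++ concatMap f xs)            ≡⟨ length-++ (f x) ⟩
    length (f x) + length (concatMap f xs)    ≤⟨ +-mono-≤ (bounded x) (length-concatMap-≤ f bounded xs) ⟩
    bound + length xs * bound                 ∎
    where open ≤-Reasoning

module _ {n : ℕ} (F : FinAbGroup n) where
  open FinAbGroup F
  open AbelianGroupProperties G using (inverseˡ-unique; ε⁻¹≈ε; ⁻¹-involutive; ⁻¹-injective; ⁻¹-∙-comm; ∙-cancelʳ)
  open CommutativeSemigroupProperties commutativeSemigroup using (interchange)
  open SetoidMembership setoid using () renaming (_∈_ to _∈≈_; _∉_ to _∉≈_)
  open SetoidMembershipProperties using (∈-resp-≈; ∈-map⁺; ∈-++⁺ˡ; ∈-++⁺ʳ)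
  open import Data.List.Membership.DecPropositional (Fin._≟_ {n}) using (_∈?_)

  mulℕ-congʳ : ∀ k {x y} → x ≈ y → mulℕ F k x ≈ mulℕ F k y
  mulℕ-congʳ zero    x≈y = refl
  mulℕ-congʳ (suc k) x≈y = ∙-cong x≈y (mulℕ-congʳ k x≈y)

  mulℕ-ε : ∀ k → mulℕ F k ε ≈ ε
  mulℕ-ε zero    = refl
  mulℕ-ε (suc k) = trans (identityˡ _) (mulℕ-ε k)

  mulℕ-distrib-∙ : ∀ k x y → mulℕ F k (x ∙ y) ≈ mulℕ F k x ∙ mulℕ F k y
  mulℕ-distrib-∙ zero    x y = sym (identityˡ ε)
  mulℕ-distrib-∙ (suc k) x y = trans (∙-congˡ (mulℕ-distrib-∙ k x y)) (interchange x y _ _)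

  mulℕ-⁻¹ : ∀ k x → mulℕ F k (x ⁻¹) ≈ mulℕ F k x ⁻¹
  mulℕ-⁻¹ k x = inverseˡ-unique _ _ (begin
    mulℕ F k (x ⁻¹) ∙ mulℕ F k x    ≈⟨ mulℕ-distrib-∙ k (x ⁻¹) x ⟨
    mulℕ F k (x ⁻¹ ∙ x)             ≈⟨ mulℕ-congʳ k (inverseˡ x) ⟩
    mulℕ F k ε                      ≈⟨ mulℕ-ε k ⟩
    ε                               ∎)
    where open SetoidReasoning setoid

  mulℤ-neg : ∀ c x → mulℤ F (- c) x ≈ mulℤ F c x ⁻¹
  mulℤ-neg (+ zero)  x = sym ε⁻¹≈ε
  mulℤ-neg (+ suc k) x = refl
  mulℤ-neg -[1+ k ]  x = sym (⁻¹-involutive _)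

  linComb : (m : ℕ) → (Fin m → ℤ) → (Fin m → Carrier) → Carrier
  linComb m c a = gsum F m (λ i → mulℤ F (c i) (a i))

  linComb-neg : ∀ m c a → linComb m (-_ ∘ c) a ≈ linComb m c a ⁻¹
  linComb-neg zero    c a = sym ε⁻¹≈ε
  linComb-neg (suc m) c a =
    trans (∙-cong (mulℤ-neg (c zero) (a zero)) (linComb-neg m (tail c) (tail a))) (⁻¹-∙-comm _ _)

  absSum-neg : ∀ m c → absSum F m (-_ ∘ c) ≡ absSum F m c
  absSum-neg zero    c = ≡.refl
  absSum-neg (suc m) c = ≡.cong₂ _+_ (∣-i∣≡∣i∣ (c zero)) (absSum-neg m (tail c))

  shifts : Carrier → (ℕ → List Carrier) → ℕ → List Carrier
  shifts b L zero    = []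
  shifts b L (suc s) = map (b ∙_) (L s ++ shifts b L s)

  -- sums m a s lists ∑ cᵢ aᵢ over all c ∈ ℤᵐ with ∑ ∣cᵢ∣ ≤ s, with repetitions.
  sums : (m : ℕ) → (Fin m → Carrier) → ℕ → List Carrier
  sums zero    a s = ε ∷ []
  sums (suc m) a s =
    sums m (tail a) s ++ (shifts (a zero) (sums m (tail a)) s ++ shifts (a zero ⁻¹) (sums m (tail a)) s)

  length-shifts : ∀ b m a s → length (shifts b (sums m a) s) ≡ ballsBelow m s
  length-sums : ∀ m a s → length (sums m a s) ≡ ball m s

  length-shifts b m a zero    = ≡.refl
  length-shifts b m a (suc s) = begin
    length (map (b ∙_) (sums m a s ++ shifts b (sums m a) s))   ≡⟨ length-map (b ∙_) (sums m a s ++ _) ⟩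
    length (sums m a s ++ shifts b (sums m a) s)                 ≡⟨ length-++ (sums m a s) ⟩
    length (sums m a s) + length (shifts b (sums m a) s)
      ≡⟨ ≡.cong₂ _+_ (length-sums m a s) (length-shifts b m a s) ⟩
    ball m s + ballsBelow m s                                    ∎
    where open ≡.≡-Reasoning

  length-sums zero    a s = ≡.refl
  length-sums (suc m) a s = begin
    length (sums m (tail a) s ++ (P ++ Q))       ≡⟨ length-++ (sums m (tail a) s) ⟩
    length (sums m (tail a) s) + length (P ++ Q) ≡⟨ ≡.cong₂ _+_ (length-sums m (tail a) s) (length-++ P) ⟩
    ball m s + (length P + length Q)
      ≡⟨ ≡.cong (λ q → ball m s + q) (≡.cong₂ _+_ (length-shifts _ m _ s) (length-shifts _ m _ s)) ⟩
    ball m s + (ballsBelow m s + ballsBelow m s) ∎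
    where
    open ≡.≡-Reasoning
    P = shifts (a zero) (sums m (tail a)) s
    Q = shifts (a zero ⁻¹) (sums m (tail a)) s

  ∈-shifts : ∀ b L l {r s y} → suc l + r ≤ s → (∀ {s′} → r ≤ s′ → y ∈≈ L s′) →
             mulℕ F (suc l) b ∙ y ∈≈ shifts b L s
  ∈-shifts b L zero    {s = suc s} (s≤s r≤s)   y∈L =
    ∈-resp-≈ setoid (∙-congʳ (sym (identityʳ b))) (∈-map⁺ setoid setoid ∙-congˡ (∈-++⁺ˡ setoid (y∈L r≤s)))
  ∈-shifts b L (suc l) {s = suc s} (s≤s l+r<s) y∈L =
    ∈-resp-≈ setoid (sym (assoc _ _ _))
      (∈-map⁺ setoid setoid ∙-congˡ (∈-++⁺ʳ setoid (L s) (∈-shifts b L l l+r<s y∈L)))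

  mulℤ∙∈sums : ∀ m a c₀ {r} s {y} → ∣ c₀ ∣ + r ≤ s → (∀ {s′} → r ≤ s′ → y ∈≈ sums m (tail a) s′) →
               mulℤ F c₀ (a zero) ∙ y ∈≈ sums (suc m) a s
  mulℤ∙∈sums m a (+ zero)  s r≤s   y∈ = ∈-++⁺ˡ setoid (∈-resp-≈ setoid (sym (identityˡ _)) (y∈ r≤s))
  mulℤ∙∈sums m a (+ suc l) s l+r≤s y∈ =
    ∈-++⁺ʳ setoid (sums m (tail a) s) (∈-++⁺ˡ setoid (∈-shifts (a zero) (sums m (tail a)) l l+r≤s y∈))
  mulℤ∙∈sums m a -[1+ l ]  s l+r≤s y∈ =
    ∈-++⁺ʳ setoid (sums m (tail a) s) (∈-++⁺ʳ setoid (shifts (a zero) (sums m (tail a)) s)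
      (∈-resp-≈ setoid (∙-congʳ (mulℕ-⁻¹ (suc l) (a zero)))
        (∈-shifts (a zero ⁻¹) (sums m (tail a)) l l+r≤s y∈)))

  linComb∈sums : ∀ m a c {s} → absSum F m c ≤ s → linComb m c a ∈≈ sums m a s
  linComb∈sums zero    a c _   = here refl
  linComb∈sums (suc m) a c r≤s = mulℤ∙∈sums m a (c zero) _ r≤s (linComb∈sums m (tail a) (tail c))

  ε∈sums : ∀ m a s → ε ∈≈ sums m a s
  ε∈sums zero    a s = here refl
  ε∈sums (suc m) a s = ∈-++⁺ˡ setoid (ε∈sums m (tail a) s)

  generator∈sums : ∀ m a i s → a i ∈≈ sums m a (suc s)
  generator∈sums (suc m) a zero    s =
    ∈-++⁺ʳ setoid (sums m (tail a) (suc s)) (∈-++⁺ˡ setoid (∈-resp-≈ setoid (identityʳ (a zero))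
      (∈-map⁺ setoid setoid ∙-congˡ (∈-++⁺ˡ setoid (ε∈sums m (tail a) s)))))
  generator∈sums (suc m) a (suc i) s = ∈-++⁺ˡ setoid (generator∈sums m (tail a) i s)

  _≟_ : ∀ x y → Dec (x ≈ y)
  _≟_ = _≈?_ F

  solutions : ∀ {k} → (Fin k → Carrier) → Carrier → List (Fin k)
  solutions f y = filter (λ i → f i ≟ y) (allFin _)

  ∈-solutions⁺ : ∀ {k} {f : Fin k → Carrier} {y i} → f i ≈ y → i ∈ solutions f y
  ∈-solutions⁺ {f = f} {y} {i} fi≈y = ∈-filter⁺ (λ j → f j ≟ y) (∈-allFin i) fi≈y

  ∈-solutions⁻ : ∀ {k} {f : Fin k → Carrier} {y i} → i ∈ solutions f y → f i ≈ y
  ∈-solutions⁻ {f = f} {y} i∈ = proj₂ (∈-filter⁻ (λ j → f j ≟ y) {xs = allFin _} i∈)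

  solutions-unique : ∀ {k} (f : Fin k → Carrier) y → Unique (solutions f y)
  solutions-unique f y = filter⁺ (λ j → f j ≟ y) (allFin⁺ _)

  length-filter-tabulate : ∀ {k k′} (f : Fin k′ → Carrier) (g : Fin k → Fin k′) →
                           length (filter (λ i → f i ≟ ε) (tabulate g)) ≡ countFin F k (f ∘ g)
  length-filter-tabulate {zero}  f g = ≡.refl
  length-filter-tabulate {suc k} f g with f (g zero) ≟ ε
  ... | yes _ = ≡.cong suc (length-filter-tabulate f (g ∘ suc))
  ... | no  _ = length-filter-tabulate f (g ∘ suc)

  length-solutions-ε : ∀ {k} (f : Fin k → Carrier) → length (solutions f ε) ≡ countFin F k f
  length-solutions-ε f = length-filter-tabulate f id

  index-injective : ∀ {x y} → index x ≡ index y → x ≈ y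
  index-injective {x} {y} eq = trans (sym (enum-index x)) (trans (reflexive (≡.cong enum eq)) (enum-index y))

  -- Translation by −x₀ maps the solutions of l·x = y injectively into Tor(G, l).
  solvable⇒length-solutions-≤-torSize : ∀ l {x₀ y} → mulℕ F l x₀ ≈ y →
                                        length (solutions (mulℕ F l ∘ enum) y) ≤ torSize F l
  solvable⇒length-solutions-≤-torSize l {x₀} {y} l·x₀≈y = let open ≤-Reasoning in begin
    length (solutions f y)                    ≡⟨ length-map translate (solutions f y) ⟨
    length (map translate (solutions f y))
      ≤⟨ unique-⊆⇒length-≤ (map⁺ translate-injective (solutions-unique f y)) map-translate-⊆ ⟩
    length (solutions f ε)                    ≡⟨ length-solutions-ε f ⟩
    torSize F l                               ∎
    where
    f : Fin n → Carrier
    f = mulℕ F l ∘ enum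

    translate : Fin n → Fin n
    translate i = index (enum i ∙ x₀ ⁻¹)

    translate-injective : ∀ {i j} → translate i ≡ translate j → i ≡ j
    translate-injective {i} {j} eq = enum-inj i j (∙-cancelʳ (x₀ ⁻¹) (enum i) (enum j) (index-injective eq))

    translate-solution : ∀ {i} → f i ≈ y → f (translate i) ≈ ε
    translate-solution {i} fi≈y = begin
      mulℕ F l (enum (translate i))         ≈⟨ mulℕ-congʳ l (enum-index _) ⟩
      mulℕ F l (enum i ∙ x₀ ⁻¹)             ≈⟨ mulℕ-distrib-∙ l (enum i) (x₀ ⁻¹) ⟩
      mulℕ F l (enum i) ∙ mulℕ F l (x₀ ⁻¹)  ≈⟨ ∙-cong fi≈y (mulℕ-⁻¹ l x₀) ⟩
      y ∙ mulℕ F l x₀ ⁻¹                    ≈⟨ ∙-congˡ (⁻¹-cong l·x₀≈y) ⟩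
      y ∙ y ⁻¹                              ≈⟨ inverseʳ y ⟩
      ε                                     ∎
      where open SetoidReasoning setoid

    map-translate-⊆ : map translate (solutions f y) ⊆ solutions f ε
    map-translate-⊆ j∈ with ∈-map⁻ translate j∈
    ... | i , i∈ , ≡.refl = ∈-solutions⁺ (translate-solution (∈-solutions⁻ i∈))

  length-solutions-≤-torSize : ∀ l y → length (solutions (mulℕ F l ∘ enum) y) ≤ torSize F l
  length-solutions-≤-torSize l y with solutions (mulℕ F l ∘ enum) y in eq
  ... | []    = z≤n
  ... | i ∷ _ = ≡.subst (λ is → length is ≤ torSize F l) eq
                  (solvable⇒length-solutions-≤-torSize l (∈-solutions⁻ (≡.subst (i ∈_) (≡.sym eq) (here ≡.refl))))

  badIndices : List Carrier → ℕ → List (Fin n)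
  badIndices S zero    = []
  badIndices S (suc l) = badIndices S l ++ concatMap (solutions (mulℕ F (suc l) ∘ enum)) S

  length-badIndices : ∀ S t → length (badIndices S t) ≤ sigma F t * length S
  length-badIndices S zero    = z≤n
  length-badIndices S (suc t) = begin
    length (badIndices S t ++ concatMap f S)                 ≡⟨ length-++ (badIndices S t) ⟩
    length (badIndices S t) + length (concatMap f S)
      ≤⟨ +-mono-≤ (length-badIndices S t) (length-concatMap-≤ f (length-solutions-≤-torSize (suc t)) S) ⟩
    sigma F t * length S + length S * torSize F (suc t)
      ≡⟨ ≡.cong (λ q → sigma F t * length S + q) (*-comm (length S) _) ⟩
    sigma F t * length S + torSize F (suc t) * length S      ≡⟨ *-distribʳ-+ (length S) (sigma F t) _ ⟨
    sigma F (suc t) * length S                               ∎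
    where
    open ≤-Reasoning
    f : Carrier → List (Fin n)
    f = solutions (mulℕ F (suc t) ∘ enum)

  ∈-badIndices : ∀ S {l t i} → suc l ≤ t → mulℕ F (suc l) (enum i) ∈≈ S → i ∈ badIndices S t
  ∈-badIndices S {l} {suc t} l<t l·i∈S with m≤n⇒m<n∨m≡n l<t
  ... | inj₁ l<t′   = ∈-++⁺ˡ (≡.setoid (Fin n)) (∈-badIndices S (≤-pred l<t′) l·i∈S)
  ... | inj₂ ≡.refl = ∈-++⁺ʳ (≡.setoid (Fin n)) (badIndices S t)
                         (∈-concatMap⁺ (solutions (mulℕ F (suc l) ∘ enum)) (Any.map ∈-solutions⁺ l·i∈S))

  Avoids : ℕ → List Carrier → Carrier → Set
  Avoids t S x = ∀ l → suc l ≤ t → mulℕ F (suc l) x ∉≈ S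

  avoider-exists : ∀ S t → length (badIndices S t) < n → Σ Carrier (Avoids t S)
  avoider-exists S t short with ¬∀⟶∃¬ n (_∈ badIndices S t) (_∈? badIndices S t) not-all-bad
    where
    not-all-bad : ¬ (∀ i → i ∈ badIndices S t)
    not-all-bad all-bad = <⇒≱ short (begin
      n                         ≡⟨ length-tabulate id ⟨
      length (allFin n)         ≤⟨ unique-⊆⇒length-≤ (allFin⁺ n) (λ {i} _ → all-bad i) ⟩
      length (badIndices S t)   ∎)
      where open ≤-Reasoning
  ... | i , i∉ = enum i , λ l l<t l·i∈S → i∉ (∈-badIndices S l<t l·i∈S)

  1≤sigma : ∀ t → 1 ≤ sigma F (suc t)
  1≤sigma t = begin
    1                         ≤⟨ nonempty (∈-solutions⁺ {f = f} ε-torsion) ⟩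
    length (solutions f ε)    ≡⟨ length-solutions-ε f ⟩
    torSize F (suc t)         ≤⟨ m≤n+m _ (sigma F t) ⟩
    sigma F (suc t)           ∎
    where
    open ≤-Reasoning
    f : Fin n → Carrier
    f = mulℕ F (suc t) ∘ enum

    ε-torsion : f (index ε) ≈ ε
    ε-torsion = trans (mulℕ-congʳ (suc t) (enum-index ε)) (mulℕ-ε (suc t))

    nonempty : ∀ {i} {is : List (Fin n)} → i ∈ is → 1 ≤ length is
    nonempty (here _)  = s≤s z≤n
    nonempty (there _) = s≤s z≤n

  ∷-distinct : ∀ {m s} {a : Fin m → Carrier} {x} → x ∉≈ sums m a (suc s) →
               Distinct F m a → Distinct F (suc m) (x Vector.∷ a)
  ∷-distinct x∉ distinct zero    zero    _   = ≡.refl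
  ∷-distinct x∉ distinct zero    (suc j) x≈a = ⊥-elim (x∉ (∈-resp-≈ setoid (sym x≈a) (generator∈sums _ _ j _)))
  ∷-distinct x∉ distinct (suc i) zero    a≈x = ⊥-elim (x∉ (∈-resp-≈ setoid a≈x (generator∈sums _ _ i _)))
  ∷-distinct x∉ distinct (suc i) (suc j) a≈a = ≡.cong suc (distinct i j a≈a)

  -- A relation c₀·x + ∑ cᵢaᵢ = 0 with c₀ = ±(l+1) would put (l+1)·x into sums m a s.
  ∷-independent : ∀ {m s} {a : Fin m → Carrier} {x} → Avoids (suc s) (sums m a s) x →
                  IsTIndependent F (suc s) m a → IsTIndependent F (suc s) (suc m) (x Vector.∷ a)
  ∷-independent {m} {s} {a} {x} avoids independent c size≤ relation = λ where
      zero    → proj₁ (coefficients (c zero) (tail c) size≤ relation)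
      (suc i) → proj₂ (coefficients (c zero) (tail c) size≤ relation) i
    where
    coefficients : ∀ c₀ cs → ∣ c₀ ∣ + absSum F m cs ≤ suc s → mulℤ F c₀ x ∙ linComb m cs a ≈ ε →
                   c₀ ≡ + 0 × (∀ i → cs i ≡ + 0)
    coefficients (+ zero)  cs size≤ relation = ≡.refl , independent cs size≤ (trans (sym (identityˡ _)) relation)
    coefficients (+ suc l) cs (s≤s size≤) relation = ⊥-elim (avoids l (s≤s (m+n≤o⇒m≤o l size≤))
      (∈-resp-≈ setoid (trans (linComb-neg m cs a) (sym (inverseˡ-unique _ _ relation)))
        (linComb∈sums m a (-_ ∘ cs) (≤-trans (≤-reflexive (absSum-neg m cs)) (m+n≤o⇒n≤o l size≤)))))
    coefficients -[1+ l ]  cs (s≤s size≤) relation = ⊥-elim (avoids l (s≤s (m+n≤o⇒m≤o l size≤))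
      (∈-resp-≈ setoid (sym (⁻¹-injective (inverseˡ-unique _ _ relation)))
        (linComb∈sums m a cs (m+n≤o⇒n≤o l size≤))))

  independentFamily : ∀ s k → 2 * sigma F (suc (suc s)) * k ^ suc (suc s) ≤ n → ∀ j → j ≤ k →
                      Σ (Fin j → Carrier) λ a → Distinct F j a × IsTIndependent F (suc (suc s)) j a
  independentFamily s k small zero    _   = (λ ()) , (λ ()) , (λ _ _ _ ())
  independentFamily s k small (suc j) j<k =
    let a , distinct , independent = independentFamily s k small j (<⇒≤ j<k)
        x , avoids = avoider-exists (sums j a (suc s)) t (few-bad a)
        x∉ : x ∉≈ sums j a (suc s)
        x∉ x∈ = avoids 0 (s≤s z≤n) (∈-resp-≈ setoid (sym (identityʳ x)) x∈)
    in x Vector.∷ a , ∷-distinct x∉ distinct , ∷-independent avoids independent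
    where
    t = suc (suc s)
    σ = sigma F t

    few-bad : ∀ a → length (badIndices (sums j a (suc s)) t) < n
    few-bad a = begin-strict
      length (badIndices (sums j a (suc s)) t) ≤⟨ length-badIndices _ t ⟩
      σ * length (sums j a (suc s))            ≡⟨ ≡.cong (σ *_) (length-sums j a (suc s)) ⟩
      σ * ball j (suc s)                       <⟨ *-monoʳ-< σ {{>-nonZero (1≤sigma (suc s))}} (ball-< j (suc s)) ⟩
      σ * (2 * suc j ^ t)                      ≤⟨ *-monoʳ-≤ σ (*-monoʳ-≤ 2 (^-monoˡ-≤ t j<k)) ⟩
      σ * (2 * k ^ t)                          ≡⟨ reorder σ (k ^ t) ⟩
      2 * σ * k ^ t                            ≤⟨ small ⟩
      n                                        ∎
      where
      open ≤-Reasoning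
      reorder : ∀ a b → a * (2 * b) ≡ 2 * a * b
      reorder = solve-∀

theorem7 : (n : ℕ) (F : FinAbGroup n) → 2 ≤ n →
    (t : ℕ) → 2 ≤ t → t ≤ n ∸ 1 →
    (k : ℕ) → 1 ≤ k → 2 * sigma F t * k ^ t ≤ n → sAtLeast F t k
theorem7 n F _ (suc zero)    (s≤s ()) _ _ _ _
theorem7 n F _ (suc (suc s)) _        _ k 1≤k small =
  let a , distinct , independent = independentFamily F s k small k ≤-refl
  in k , 1≤k , ≤-refl , a , distinct , independent
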